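{- For every $n\ge 5$, the $n$-wheel graph $W_n$ is not a proper max-point-tolerance graph.
   Context: The $n$-wheel $W_n$ is the graph obtained from the cycle $C_n$ by adding one new vertex adjacent to all $n$ vertices of the cycle. $G=(V,E)$ (finite, simple, undirected) is a max-point-tolerance graph (MPTG) if each vertex $u$ can be assigned a pair $(I_u,p_u)$, with $I_u$ a closed bounded real interval and $p_u\in I_u$, such that for distinct $u,v$, $uv\in E$ iff $\{p_u,p_v\}\subseteq I_u\cap I_v$. It is a proper MPTG if it has such a representation in which no interval properly contains another. -}

module Defs where

open import Level using (Level; _⊔_)
open import Data.Nat using (ℕ; zero; suc)
open import Data.Fin using (Fin; toℕ)
import Data.Fin as F
open import Data.Unit using (⊤)
open import Data.Empty using (⊥)
open import Data.Product using (_×_)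
open import Data.Sum using (_⊎_)
open import Relation.Nullary using (¬_)
open import Relation.Binary.PropositionalEquality using (_≡_; _≢_)
open import Relation.Binary.Bundles using (TotalOrder)
open import Function.Bundles using (_⇔_)

Graph : ℕ → Set₁
Graph m = Fin m → Fin m → Set

CycleAdj : (n : ℕ) → Fin n → Fin n → Set
CycleAdj n i j =
    (suc (toℕ i) ≡ toℕ j)
  ⊎ (suc (toℕ j) ≡ toℕ i)
  ⊎ (toℕ i ≡ 0 × suc (toℕ j) ≡ n)
  ⊎ (toℕ j ≡ 0 × suc (toℕ i) ≡ n)

-- Wheel W_n on Fin (suc n): vertex zero is the hub, vertex suc i is cycle vertex i.
Wheel : (n : ℕ) → Graph (suc n)
Wheel n F.zero    F.zero    = ⊥
Wheel n F.zero    (F.suc _) = ⊤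
Wheel n (F.suc _) F.zero    = ⊤
Wheel n (F.suc i) (F.suc j) = CycleAdj n i j

-- Max-point-tolerance representations with endpoints/points in a totally
-- ordered set O (the paper uses O = ℝ).
module _ {c ℓ₁ ℓ₂ : Level} (O : TotalOrder c ℓ₁ ℓ₂) where
  open TotalOrder O renaming (Carrier to A)

  record Interval : Set (c ⊔ ℓ₂) where
    constructor [_,_]⟨_⟩
    field
      lo  : A
      hi  : A
      lo≤hi : lo ≤ hi
  open Interval public

  _∈I_ : A → Interval → Set ℓ₂
  x ∈I I = (lo I ≤ x) × (x ≤ hi I)

  _⊆I_ : Interval → Interval → Set ℓ₂
  I ⊆I J = (lo J ≤ lo I) × (hi I ≤ hi J)

  _⊂I_ : Interval → Interval → Set (ℓ₁ ⊔ ℓ₂)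
  I ⊂I J = (I ⊆I J) × ¬ ((lo I ≈ lo J) × (hi I ≈ hi J))

  record MPTRep {m : ℕ} (G : Graph m) : Set (c ⊔ ℓ₁ ⊔ ℓ₂) where
    field
      I   : Fin m → Interval
      p   : Fin m → A
      p∈I : ∀ u → p u ∈I I u
      edge : ∀ u v → u ≢ v →
             G u v ⇔ ((p u ∈I I u × p u ∈I I v) × (p v ∈I I u × p v ∈I I v))

  record ProperMPTRep {m : ℕ} (G : Graph m) : Set (c ⊔ ℓ₁ ⊔ ℓ₂) where
    field
      rep    : MPTRep G
      proper : ∀ u v → ¬ (MPTRep.I rep u ⊂I MPTRep.I rep v)

module Submission where

-- In a proper representation of W_n every rim point lies in the hub interval, and by
-- properness each rim interval either is shifted to the right of the hub interval or starts
-- no later than it.  Reading u ≺ w as "the interval of u lies to the left of that of w"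
-- (within each side by comparing an endpoint with a point, across the sides by
-- non-adjacency), any two non-adjacent rim vertices are comparable, while no path
-- u ≺ v ≺ w joins two adjacent ones.  On a cycle of length at least 5 no such relation
-- exists: from 0 ≺ 2 one gets 0 ≺ 3, 1 ≺ 3, 1 ≺ 4, and walking back around the cycle from
-- n - 1 also 4 ≺ 2, but 1 and 2 are adjacent.  The order on O is not decidable, so
-- comparability only holds up to double negation, which suffices for a contradiction.

open import Defs
open import Data.Nat using (ℕ; _≤_; _<_; zero; suc; _+_; s≤s; z≤n)
open import Data.Nat.Properties using (1+n≰n; ≤-trans; <⇒≤; m≤m+n; +-monoʳ-≤; m≤n+m; +-identityʳ; +-suc)
open import Data.Fin using (Fin; toℕ; fromℕ<; #_)
import Data.Fin as F
open import Data.Fin.Properties using (suc-injective; toℕ<n; toℕ-fromℕ<)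
open import Data.Empty using (⊥)
open import Data.Unit using (tt)
open import Data.Product using (_×_; _,_; proj₁; proj₂; swap)
open import Data.Sum using (_⊎_; inj₁; inj₂)
import Data.Sum as Sum
open import Function using (flip; _∘_; case_of_)
open import Function.Bundles using (Equivalence)
open import Relation.Binary.Core using (Rel)
open import Relation.Binary.Bundles using (TotalOrder)
open import Relation.Binary.PropositionalEquality using (_≡_; _≢_; refl; sym; trans; cong; subst)
open import Relation.Nullary using (¬_; Dec; yes; no)
open import Relation.Nullary.Decidable using (¬¬-excluded-middle)

cycleAdj-sym : ∀ {n} {i j : Fin n} → CycleAdj n i j → CycleAdj n j i
cycleAdj-sym (inj₁ e)                = inj₂ (inj₁ e)
cycleAdj-sym (inj₂ (inj₁ e))         = inj₁ e
cycleAdj-sym (inj₂ (inj₂ (inj₁ e)))  = inj₂ (inj₂ (inj₂ e))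
cycleAdj-sym (inj₂ (inj₂ (inj₂ e)))  = inj₂ (inj₂ (inj₁ e))

-- The second hypothesis bounds the distance from j forward to i (across n - 1 → 0).
¬cycleAdj-apart : ∀ {n} {i j : Fin n} →
  2 + toℕ i ≤ toℕ j → 2 + toℕ j ≤ toℕ i + n → ¬ CycleAdj n i j
¬cycleAdj-apart {i = i} i+2≤j _ (inj₁ i+1≡j) =
  1+n≰n (subst (2 + toℕ i ≤_) (sym i+1≡j) i+2≤j)
¬cycleAdj-apart {j = j} i+2≤j _ (inj₂ (inj₁ j+1≡i)) =
  1+n≰n (≤-trans (m≤n+m _ 2) (subst (λ m → 2 + m ≤ toℕ j) (sym j+1≡i) i+2≤j))
¬cycleAdj-apart {n} {i} {j} _ j+2≤i+n (inj₂ (inj₂ (inj₁ (i≡0 , j+1≡n)))) =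
  1+n≰n (subst (2 + toℕ j ≤_) (trans (cong (_+ n) i≡0) (sym j+1≡n)) j+2≤i+n)
¬cycleAdj-apart {i = i} i+2≤j _ (inj₂ (inj₂ (inj₂ (j≡0 , _)))) =
  case subst (2 + toℕ i ≤_) j≡0 i+2≤j of λ ()

NonAdjacentComparable : ∀ {ℓ} n → Rel (Fin n) ℓ → Set ℓ
NonAdjacentComparable n _≺_ =
  ∀ u w → u ≢ w → ¬ CycleAdj n u w → ¬ ¬ (u ≺ w ⊎ w ≺ u)

NoTwoStepAcrossEdge : ∀ {ℓ} n → Rel (Fin n) ℓ → Set ℓ
NoTwoStepAcrossEdge n _≺_ = ∀ {u v w} → u ≺ v → v ≺ w → ¬ CycleAdj n u w

nonAdjacentComparable-flip : ∀ {ℓ n} {_≺_ : Rel (Fin n) ℓ} →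
  NonAdjacentComparable n _≺_ → NonAdjacentComparable n (flip _≺_)
nonAdjacentComparable-flip cmp u w u≢w u≁w ¬cmp = cmp u w u≢w u≁w (¬cmp ∘ Sum.swap)

noTwoStepAcrossEdge-flip : ∀ {ℓ n} {_≺_ : Rel (Fin n) ℓ} →
  NoTwoStepAcrossEdge n _≺_ → NoTwoStepAcrossEdge n (flip _≺_)
noTwoStepAcrossEdge-flip nts v≺u w≺v = nts w≺v v≺u ∘ cycleAdj-sym

module _ {ℓ} {k : ℕ} {_≺_ : Rel (Fin (5 + k)) ℓ}
         (comparable : NonAdjacentComparable (5 + k) _≺_)
         (no-two-step : NoTwoStepAcrossEdge (5 + k) _≺_) where

  private
    n : ℕ
    n = 5 + k

    extendˡ : ∀ {x y z} → x ≺ y → CycleAdj n x z → z ≢ y → ¬ CycleAdj n z y → ¬ ¬ (z ≺ y)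
    extendˡ x≺y x~z z≢y z≁y ¬z≺y = comparable _ _ z≢y z≁y λ where
      (inj₁ z≺y) → ¬z≺y z≺y
      (inj₂ y≺z) → no-two-step x≺y y≺z x~z

    extendʳ : ∀ {x y z} → x ≺ y → CycleAdj n z y → x ≢ z → ¬ CycleAdj n x z → ¬ ¬ (x ≺ z)
    extendʳ x≺y z~y x≢z x≁z ¬x≺z = comparable _ _ x≢z x≁z λ where
      (inj₁ x≺z) → ¬x≺z x≺z
      (inj₂ z≺x) → no-two-step z≺x x≺y z~y

    ≢2 : ∀ {u : Fin n} {d} → toℕ u ≡ 4 + d → u ≢ # 2
    ≢2 u≡4+d refl = case u≡4+d of λ ()

    ≁2 : ∀ {u : Fin n} {d} → toℕ u ≡ 4 + d → ¬ CycleAdj n u (# 2)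
    ≁2 {u} {d} u≡4+d = ¬cycleAdj-apart 4≤u (s≤s (s≤s (<⇒≤ (toℕ<n u)))) ∘ cycleAdj-sym
      where
      4≤u : 4 ≤ toℕ u
      4≤u = subst (4 ≤_) (sym u≡4+d) (m≤m+n 4 d)

    -- Walk backwards around the cycle from n - 1, the neighbour of 0, down to 4;
    -- e counts the remaining steps.
    beyond-3-≺-2 : (# 0) ≺ (# 2) → ∀ e {d} → d + e ≡ k → (u : Fin n) → toℕ u ≡ 4 + d → ¬ ¬ (u ≺ (# 2))
    beyond-3-≺-2 0≺2 zero {d} d+0≡k u u≡4+d =
      extendˡ 0≺2 (inj₂ (inj₂ (inj₁ (refl , cong suc u≡4+k)))) (≢2 u≡4+d) (≁2 u≡4+d)
      where
      u≡4+k : toℕ u ≡ 4 + k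
      u≡4+k = trans u≡4+d (cong (4 +_) (trans (sym (+-identityʳ d)) d+0≡k))
    beyond-3-≺-2 0≺2 (suc e) {d} d+1+e≡k u u≡4+d ¬u≺2 =
      beyond-3-≺-2 0≺2 e 1+d+e≡k u⁺ (toℕ-fromℕ< 5+d<n) λ u⁺≺2 →
      extendˡ u⁺≺2 (inj₂ (inj₁ (trans (cong suc u≡4+d) (sym (toℕ-fromℕ< 5+d<n)))))
              (≢2 u≡4+d) (≁2 u≡4+d) ¬u≺2
      where
      1+d+e≡k : suc d + e ≡ k
      1+d+e≡k = trans (sym (+-suc d e)) d+1+e≡k
      5+d<n : 4 + suc d < n
      5+d<n = +-monoʳ-≤ 5 (subst (suc d ≤_) 1+d+e≡k (m≤m+n (suc d) e))
      u⁺ : Fin n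
      u⁺ = fromℕ< 5+d<n

  0⊀2 : ¬ ((# 0) ≺ (# 2))
  0⊀2 0≺2 =
    extendʳ 0≺2 (inj₂ (inj₁ refl)) (λ ()) (¬cycleAdj-apart (m≤m+n _ _) (m≤m+n _ _)) λ 0≺3 →
    extendˡ 0≺3 (inj₁ refl) (λ ()) (¬cycleAdj-apart (m≤m+n _ _) (m≤m+n _ _)) λ 1≺3 →
    extendʳ 1≺3 (inj₂ (inj₁ refl)) (λ ()) (¬cycleAdj-apart (m≤m+n _ _) (m≤m+n _ _)) λ 1≺4 →
    beyond-3-≺-2 0≺2 k refl (# 4) refl λ 4≺2 →
    no-two-step 1≺4 4≺2 (inj₁ refl)

no-ordering-of-long-cycle : ∀ {ℓ} k (_≺_ : Rel (Fin (5 + k)) ℓ) →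
  NonAdjacentComparable (5 + k) _≺_ → NoTwoStepAcrossEdge (5 + k) _≺_ → ⊥
no-ordering-of-long-cycle k _≺_ cmp nts =
  cmp (# 0) (# 2) (λ ()) (¬cycleAdj-apart (m≤m+n _ _) (m≤m+n _ _)) λ where
    (inj₁ 0≺2) → 0⊀2 cmp nts 0≺2
    (inj₂ 2≺0) → 0⊀2 (nonAdjacentComparable-flip cmp) (noTwoStepAcrossEdge-flip nts) 2≺0

module ProperWheelRep {c ℓ₁ ℓ₂} {O : TotalOrder c ℓ₁ ℓ₂} {n : ℕ}
                      (R : ProperMPTRep O (Wheel n)) where

  open TotalOrder O renaming (Carrier to X; _≤_ to _⊑_; _≰_ to _⋢_; trans to ⊑-trans)
  open import Relation.Binary.Properties.TotalOrder O using (≰⇒≥)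
  open ProperMPTRep R
  open MPTRep rep

  _∈ᵣ_ : X → Fin n → Set ℓ₂
  x ∈ᵣ u = _∈I_ O x (I (F.suc u))

  loₕ hiₕ : X
  loₕ = lo (I F.zero)
  hiₕ = hi (I F.zero)

  loᵣ hiᵣ pᵣ : Fin n → X
  loᵣ u = lo (I (F.suc u))
  hiᵣ u = hi (I (F.suc u))
  pᵣ u = p (F.suc u)

  pᵣ∈hub : ∀ u → _∈I_ O (pᵣ u) (I F.zero)
  pᵣ∈hub u = proj₁ (proj₂ (Equivalence.to (edge F.zero (F.suc u) (λ ())) tt))

  loₕ⊑pᵣ : ∀ u → loₕ ⊑ pᵣ u
  loₕ⊑pᵣ = proj₁ ∘ pᵣ∈hub

  pᵣ⊑hiₕ : ∀ u → pᵣ u ⊑ hiₕ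
  pᵣ⊑hiₕ = proj₂ ∘ pᵣ∈hub

  loᵣ⊑pᵣ : ∀ u → loᵣ u ⊑ pᵣ u
  loᵣ⊑pᵣ u = proj₁ (p∈I (F.suc u))

  pᵣ⊑hiᵣ : ∀ u → pᵣ u ⊑ hiᵣ u
  pᵣ⊑hiᵣ u = proj₂ (p∈I (F.suc u))

  Overlap : Fin n → Fin n → Set ℓ₂
  Overlap u w = pᵣ u ∈ᵣ w × pᵣ w ∈ᵣ u

  cycleAdj⇒overlap : ∀ {u w} → CycleAdj n u w → Overlap u w
  cycleAdj⇒overlap {u} {w} u~w with u F.≟ w
  ... | yes refl = p∈I (F.suc u) , p∈I (F.suc u)
  ... | no u≢w =
    let (_ , pu∈w) , (pw∈u , _) = Equivalence.to (edge _ _ (u≢w ∘ suc-injective)) u~w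
    in pu∈w , pw∈u

  overlap⇒cycleAdj : ∀ {u w} → u ≢ w → Overlap u w → CycleAdj n u w
  overlap⇒cycleAdj {u} {w} u≢w (pu∈w , pw∈u) =
    Equivalence.from (edge _ _ (u≢w ∘ suc-injective)) ((p∈I (F.suc u) , pu∈w) , (pw∈u , p∈I (F.suc w)))

  RightOfHub : Fin n → Set ℓ₂
  RightOfHub u = loₕ ⊑ loᵣ u × hiₕ ⊑ hiᵣ u

  -- Properness forbids I_u ⊊ I_hub, the only other possibility.
  ¬rightOfHub⇒loᵣ⊑loₕ : ∀ u → ¬ RightOfHub u → ¬ ¬ (loᵣ u ⊑ loₕ)
  ¬rightOfHub⇒loᵣ⊑loₕ u ¬right ¬lu⊑lh with total (loᵣ u) loₕ | total hiₕ (hiᵣ u)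
  ... | inj₁ lu⊑lh | _         = ¬lu⊑lh lu⊑lh
  ... | inj₂ lh⊑lu | inj₁ hh⊑hu = ¬right (lh⊑lu , hh⊑hu)
  ... | inj₂ lh⊑lu | inj₂ hu⊑hh = proper (F.suc u) F.zero ((lh⊑lu , hu⊑hh) , ¬lu⊑lh ∘ reflexive ∘ proj₁)

  data _≺_ (u w : Fin n) : Set ℓ₂ where
    left-left   : ¬ RightOfHub u → ¬ RightOfHub w → pᵣ w ⋢ hiᵣ u → u ≺ w
    right-right : RightOfHub u → RightOfHub w → loᵣ w ⋢ pᵣ u → u ≺ w
    left-right  : ¬ RightOfHub u → RightOfHub w → ¬ Overlap u w → u ≺ w

  ≺-comparable : NonAdjacentComparable n _≺_
  ≺-comparable u w u≢w u≁w ¬cmp =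
    ¬¬-excluded-middle λ side-u → ¬¬-excluded-middle λ side-w → by-sides side-u side-w
    where
    ¬overlap : ¬ Overlap u w
    ¬overlap = u≁w ∘ overlap⇒cycleAdj u≢w

    by-sides : Dec (RightOfHub u) → Dec (RightOfHub w) → ⊥
    by-sides (no ¬ru) (yes rw) = ¬cmp (inj₁ (left-right ¬ru rw ¬overlap))
    by-sides (yes ru) (no ¬rw) = ¬cmp (inj₂ (left-right ¬rw ru (¬overlap ∘ swap)))
    by-sides (yes ru) (yes rw) = ¬¬-excluded-middle λ where
      (no lw⋢pu)  → ¬cmp (inj₁ (right-right ru rw lw⋢pu))
      (yes lw⊑pu) → ¬¬-excluded-middle λ where
        (no lu⋢pw)  → ¬cmp (inj₂ (right-right rw ru lu⋢pw))
        (yes lu⊑pw) → ¬overlap ( (lw⊑pu , ⊑-trans (pᵣ⊑hiₕ u) (proj₂ rw))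
                               , (lu⊑pw , ⊑-trans (pᵣ⊑hiₕ w) (proj₂ ru)))
    by-sides (no ¬ru) (no ¬rw) = ¬¬-excluded-middle λ where
      (no pw⋢hu)  → ¬cmp (inj₁ (left-left ¬ru ¬rw pw⋢hu))
      (yes pw⊑hu) → ¬¬-excluded-middle λ where
        (no pu⋢hw)  → ¬cmp (inj₂ (left-left ¬rw ¬ru pu⋢hw))
        (yes pu⊑hw) → ¬rightOfHub⇒loᵣ⊑loₕ u ¬ru λ lu⊑lh → ¬rightOfHub⇒loᵣ⊑loₕ w ¬rw λ lw⊑lh →
          ¬overlap ((⊑-trans lw⊑lh (loₕ⊑pᵣ u) , pu⊑hw) , (⊑-trans lu⊑lh (loₕ⊑pᵣ w) , pw⊑hu))

  ≺-no-two-step : NoTwoStepAcrossEdge n _≺_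
  ≺-no-two-step {u} {v} {w} u≺v v≺w u~w = chain u≺v v≺w
    where
    lw⊑pu : loᵣ w ⊑ pᵣ u
    lw⊑pu = proj₁ (proj₁ (cycleAdj⇒overlap u~w))
    pw⊑hu : pᵣ w ⊑ hiᵣ u
    pw⊑hu = proj₂ (proj₂ (cycleAdj⇒overlap u~w))

    chain : u ≺ v → v ≺ w → ⊥
    chain (left-left _ _ pv⋢hu) (left-left _ _ pw⋢hv) =
      pw⋢hv (⊑-trans pw⊑hu (⊑-trans (≰⇒≥ pv⋢hu) (pᵣ⊑hiᵣ v)))
    chain (right-right _ _ lv⋢pu) (right-right _ _ lw⋢pv) =
      lw⋢pv (⊑-trans lw⊑pu (⊑-trans (≰⇒≥ lv⋢pu) (loᵣ⊑pᵣ v)))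
    chain (left-left _ ¬rv pv⋢hu) (left-right _ rw ¬overlap) =
      ¬rightOfHub⇒loᵣ⊑loₕ v ¬rv λ lv⊑lh → ¬overlap
        ( (⊑-trans lw⊑pu (⊑-trans (pᵣ⊑hiᵣ u) hu⊑pv) , ⊑-trans (pᵣ⊑hiₕ v) (proj₂ rw))
        , (⊑-trans lv⊑lh (loₕ⊑pᵣ w) , ⊑-trans pw⊑hu (⊑-trans hu⊑pv (pᵣ⊑hiᵣ v))))
      where
      hu⊑pv : hiᵣ u ⊑ pᵣ v
      hu⊑pv = ≰⇒≥ pv⋢hu
    chain (left-right ¬ru rv ¬overlap) (right-right _ _ lw⋢pv) =
      ¬rightOfHub⇒loᵣ⊑loₕ u ¬ru λ lu⊑lh → ¬overlap
        ( (⊑-trans (loᵣ⊑pᵣ v) (⊑-trans pv⊑lw lw⊑pu) , ⊑-trans (pᵣ⊑hiₕ u) (proj₂ rv))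
        , (⊑-trans lu⊑lh (loₕ⊑pᵣ v) , ⊑-trans pv⊑lw (⊑-trans (loᵣ⊑pᵣ w) pw⊑hu)))
      where
      pv⊑lw : pᵣ v ⊑ loᵣ w
      pv⊑lw = ≰⇒≥ lw⋢pv
    chain (left-left _ ¬rv _)  (right-right rv _ _) = ¬rv rv
    chain (right-right _ rv _) (left-left ¬rv _ _)  = ¬rv rv
    chain (right-right _ rv _) (left-right ¬rv _ _) = ¬rv rv
    chain (left-right _ rv _)  (left-left ¬rv _ _)  = ¬rv rv
    chain (left-right _ rv _)  (left-right ¬rv _ _) = ¬rv rv

corollary3p8 : ∀ (n : ℕ) → 5 ≤ n →
    ∀ {c ℓ₁ ℓ₂} (O : TotalOrder c ℓ₁ ℓ₂) → ¬ ProperMPTRep O (Wheel n)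
corollary3p8 .(5 + k) (s≤s (s≤s (s≤s (s≤s (s≤s (z≤n {k})))))) O R =
  no-ordering-of-long-cycle k _≺_ ≺-comparable ≺-no-two-step
  where open ProperWheelRep R
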